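{- Let $v>k>i\ge 0$ be integers with $v\ge 2k$ and $(v,k,i)\neq(2k,k,0)$, let $X=J(v,k,i)$ and $\Delta=v-2k+2i$. Then the odd girth of $X$ is $$og(X)=2\left\lceil\frac{k-i}{\Delta}\right\rceil+1.$$
   Context: For integers $v>k>i\ge 0$, the generalized Johnson graph $J(v,k,i)$ is the simple undirected graph whose vertices are the $k$-element subsets of a fixed $v$-element set, two vertices $A,B$ being adjacent iff $|A\cap B|=i$. The odd girth is the length of a shortest odd cycle. -}

module Defs where

open import Data.Nat using (ℕ; zero; suc; _+_; _*_; _∸_; _/_; _≤_)
open import Data.Bool using (Bool)
open import Data.Fin using (Fin; zero; suc; inject₁; fromℕ)
open import Data.Fin.Subset using (Subset; _∩_; ∣_∣)
open import Data.Nat.Properties using (_≟_)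
open import Data.Product using (_×_; Σ; ∃)
open import Function.Definitions using (Injective)
open import Relation.Binary.PropositionalEquality using (_≡_)

IsVertex : (v k : ℕ) → Subset v → Set
IsVertex v k A = ∣ A ∣ ≡ k

-- adjacency: |A ∩ B| = i  (since i < k, this is irreflexive on k-subsets)
Adj : (v i : ℕ) → Subset v → Subset v → Set
Adj v i A B = ∣ A ∩ B ∣ ≡ i

record Cycle (v k i m : ℕ) : Set where
  field
    length≥3 : 3 ≤ suc m
    vert     : Fin (suc m) → Subset v
    isVert   : ∀ j → IsVertex v k (vert j)
    distinct : Injective _≡_ _≡_ vert
    step     : ∀ (j : Fin m) → Adj v i (vert (inject₁ j)) (vert (suc j))
    close    : Adj v i (vert (fromℕ m)) (vert zero)

Odd : ℕ → Set
Odd n = Σ ℕ (λ t → n ≡ suc (2 * t))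

OddGirth : (v k i g : ℕ) → Set
OddGirth v k i g =
  Σ ℕ (λ m → suc m ≡ g × Odd g × Cycle v k i m)
  × (∀ m → Odd (suc m) → Cycle v k i m → g ≤ suc m)

-- ceiling division ⌈a / b⌉ for b > 0 (value at b = 0 is irrelevant: unused)
ceilDiv : ℕ → ℕ → ℕ
ceilDiv a zero    = 0
ceilDiv a (suc b) = (a + b) / suc b

-- Write Δ = v − 2k + 2i. Lower bound: along a closed walk U₀, U₁, … in J(v,k,i) the overlaps
-- aⱼ = |Uⱼ ∩ U₀| satisfy a₁ = i and aⱼ₊₂ ≤ aⱼ + Δ (inclusion–exclusion for the k-sets Uⱼ, Uⱼ₊₁, U₀
-- and for Uⱼ₊₁, Uⱼ₊₂, U₀). A closed walk of odd length 2s + 1 returns to U₀, where the overlap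
-- is k, so k ≤ i + sΔ, i.e. s ≥ ⌈(k − i)/Δ⌉.
-- Upper bound: write k − i = x + TΔ with 1 ≤ x ≤ Δ, so that ⌈(k − i)/Δ⌉ = T + 1. Put the v
-- points on a circle. An arc of k consecutive points meets its rotation by c = k − i in i points,
-- so the rotations of one arc by 0, c, …, (2T + 1)c form a walk; as (2T + 1)c ≡ x (mod v), a k-set
-- meeting both the arc and its rotation by x in i points, which exists because x ≤ Δ, closes it
-- into a closed walk of length 2T + 3. A repeated vertex would split this walk into two closed
-- walks, one of them odd and shorter, contradicting the lower bound; so it is a cycle.

module Submission where

open import Data.Bool using (Bool; true; false; _∧_; if_then_else_)
open import Data.Fin using (Fin; zero; suc; toℕ; inject₁; fromℕ; fromℕ<)
open import Data.Fin.Properties using (toℕ-injective; toℕ-inject₁; toℕ-fromℕ; toℕ-fromℕ<; toℕ<n)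
open import Data.Fin.Subset using (Subset; inside; outside; _∩_; _∪_; _⊆_; ∣_∣)
open import Data.Fin.Subset.Properties
  using (∩-comm; ∩-idem; ∩-distribʳ-∪; p∩q⊆p; p∩q⊆q; x∈p∩q⁺; p⊆q⇒∣p∣≤∣q∣; ∣p∩q∣≤∣q∣; ∣p∣≤n)
open import Data.List using (List; []; _∷_; [_]; _++_; _∷ʳ_; length; replicate; map; zipWith)
open import Data.List.Properties
  using (length-++; ++-assoc; ++-identityʳ; length-replicate; zipWith-replicate; length-zipWith; ∷-injective)
open import Data.List.Relation.Binary.Pointwise using (Pointwise; []; _∷_)
open import Data.Nat using (ℕ; zero; suc; _+_; _*_; _∸_; _⊓_; _≤_; _<_; z≤n; s≤s; s≤s⁻¹; z<s; NonZero)
open import Data.Nat.DivMod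
  using (_/_; _%_; _mod_; m≡m%n+[m/n]*n; m%n<n; m<n*o⇒m/o<n; [m+kn]%n≡m%n; [m+n]%n≡m%n; m<n⇒m%n≡m; n%n≡0)
open import Data.Nat.ListAction using (sum)
open import Data.Nat.Properties
open import Data.Nat.Tactic.RingSolver using (solve-∀)
open import Data.Product using (Σ; _×_; _,_; proj₁; proj₂)
open import Data.Sum as Sum using (_⊎_; inj₁; inj₂; [_,_]′)
open import Data.Vec using ([]; _∷_)
open import Relation.Binary using (tri<; tri≈; tri>)
open import Relation.Binary.PropositionalEquality hiding ([_]; J)
open import Relation.Nullary using (¬_; contradiction)

open import Defs

∣p∩q∣+∣p∪q∣≡∣p∣+∣q∣ : ∀ {n} (p q : Subset n) → ∣ p ∩ q ∣ + ∣ p ∪ q ∣ ≡ ∣ p ∣ + ∣ q ∣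
∣p∩q∣+∣p∪q∣≡∣p∣+∣q∣ []            []            = refl
∣p∩q∣+∣p∪q∣≡∣p∣+∣q∣ (inside  ∷ p) (inside  ∷ q) =
  cong suc (trans (+-suc _ _) (trans (cong suc (∣p∩q∣+∣p∪q∣≡∣p∣+∣q∣ p q)) (sym (+-suc _ _))))
∣p∩q∣+∣p∪q∣≡∣p∣+∣q∣ (inside  ∷ p) (outside ∷ q) = trans (+-suc _ _) (cong suc (∣p∩q∣+∣p∪q∣≡∣p∣+∣q∣ p q))
∣p∩q∣+∣p∪q∣≡∣p∣+∣q∣ (outside ∷ p) (inside  ∷ q) =
  trans (+-suc _ _) (trans (cong suc (∣p∩q∣+∣p∪q∣≡∣p∣+∣q∣ p q)) (sym (+-suc _ _)))
∣p∩q∣+∣p∪q∣≡∣p∣+∣q∣ (outside ∷ p) (outside ∷ q) = ∣p∩q∣+∣p∪q∣≡∣p∣+∣q∣ p q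

∣p∪q∣≤∣p∣+∣q∣ : ∀ {n} (p q : Subset n) → ∣ p ∪ q ∣ ≤ ∣ p ∣ + ∣ q ∣
∣p∪q∣≤∣p∣+∣q∣ p q = subst (∣ p ∪ q ∣ ≤_) (∣p∩q∣+∣p∪q∣≡∣p∣+∣q∣ p q) (m≤n+m _ _)

∣p∩r∣+∣q∩r∣≤∣p∩q∣+∣r∣ : ∀ {n} (p q r : Subset n) → ∣ p ∩ r ∣ + ∣ q ∩ r ∣ ≤ ∣ p ∩ q ∣ + ∣ r ∣
∣p∩r∣+∣q∩r∣≤∣p∩q∣+∣r∣ p q r = begin
  ∣ p ∩ r ∣ + ∣ q ∩ r ∣                           ≡⟨ ∣p∩q∣+∣p∪q∣≡∣p∣+∣q∣ (p ∩ r) (q ∩ r) ⟨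
  ∣ (p ∩ r) ∩ (q ∩ r) ∣ + ∣ (p ∩ r) ∪ (q ∩ r) ∣   ≤⟨ +-monoˡ-≤ _ (p⊆q⇒∣p∣≤∣q∣ meet⊆) ⟩
  ∣ p ∩ q ∣ + ∣ (p ∩ r) ∪ (q ∩ r) ∣               ≡⟨ cong (λ s → ∣ p ∩ q ∣ + ∣ s ∣) (∩-distribʳ-∪ r p q) ⟨
  ∣ p ∩ q ∣ + ∣ (p ∪ q) ∩ r ∣                     ≤⟨ +-monoʳ-≤ _ (∣p∩q∣≤∣q∣ (p ∪ q) r) ⟩
  ∣ p ∩ q ∣ + ∣ r ∣                               ∎
  where
  open ≤-Reasoning
  meet⊆ : (p ∩ r) ∩ (q ∩ r) ⊆ p ∩ q
  meet⊆ x∈ = x∈p∩q⁺ (p∩q⊆p p r (p∩q⊆p _ _ x∈) , p∩q⊆p q r (p∩q⊆q _ _ x∈))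

∣p∣+∣q∣+∣r∣≤∣p∩q∣+∣p∩r∣+∣q∩r∣+n : ∀ {n} (p q r : Subset n) →
  ∣ p ∣ + ∣ q ∣ + ∣ r ∣ ≤ ∣ p ∩ q ∣ + (∣ p ∩ r ∣ + ∣ q ∩ r ∣ + n)
∣p∣+∣q∣+∣r∣≤∣p∩q∣+∣p∩r∣+∣q∩r∣+n {n} p q r = begin
  ∣ p ∣ + ∣ q ∣ + ∣ r ∣                                 ≡⟨ cong (_+ ∣ r ∣) (∣p∩q∣+∣p∪q∣≡∣p∣+∣q∣ p q) ⟨
  ∣ p ∩ q ∣ + ∣ p ∪ q ∣ + ∣ r ∣                         ≡⟨ +-assoc ∣ p ∩ q ∣ _ _ ⟩
  ∣ p ∩ q ∣ + (∣ p ∪ q ∣ + ∣ r ∣)                       ≡⟨ cong (∣ p ∩ q ∣ +_) (∣p∩q∣+∣p∪q∣≡∣p∣+∣q∣ (p ∪ q) r) ⟨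
  ∣ p ∩ q ∣ + (∣ (p ∪ q) ∩ r ∣ + ∣ (p ∪ q) ∪ r ∣)       ≤⟨ +-monoʳ-≤ ∣ p ∩ q ∣ (+-mono-≤ union∩r (∣p∣≤n ((p ∪ q) ∪ r))) ⟩
  ∣ p ∩ q ∣ + (∣ p ∩ r ∣ + ∣ q ∩ r ∣ + n)               ∎
  where
  open ≤-Reasoning
  union∩r : ∣ (p ∪ q) ∩ r ∣ ≤ ∣ p ∩ r ∣ + ∣ q ∩ r ∣
  union∩r = subst (_≤ ∣ p ∩ r ∣ + ∣ q ∩ r ∣) (cong ∣_∣ (sym (∩-distribʳ-∪ r p q)))
                  (∣p∪q∣≤∣p∣+∣q∣ (p ∩ r) (q ∩ r))

-- Odd closed walks in J(v,k,i) are long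

private
  two-step-arith : ∀ {k i a b c d} → k + k + k ≤ i + (a + b + (2 * k + d)) → b + c ≤ i + k →
                   c ≤ a + (d + 2 * i)
  two-step-arith {k} {i} {a} {b} {c} {d} h₁ h₂ =
    +-cancelˡ-≤ (k + k + k + b) c (a + (d + 2 * i)) (begin
      k + k + k + b + c                            ≡⟨ regroup k b c ⟩
      (k + k + k) + (b + c)                        ≤⟨ +-mono-≤ h₁ h₂ ⟩
      i + (a + b + (2 * k + d)) + (i + k)          ≡⟨ collect k i a b d ⟩
      k + k + k + b + (a + (d + 2 * i))            ∎)
    where
    open ≤-Reasoning
    regroup : ∀ k b c → k + k + k + b + c ≡ (k + k + k) + (b + c)
    regroup = solve-∀
    collect : ∀ k i a b d → i + (a + b + (2 * k + d)) + (i + k) ≡ k + k + k + b + (a + (d + 2 * i))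
    collect = solve-∀

module _ {v k i d : ℕ} (2k+d≡v : 2 * k + d ≡ v) where

  meet-after-two-steps : ∀ (A B C D : Subset v) →
    IsVertex v k A → IsVertex v k B → IsVertex v k D → Adj v i A B → Adj v i B C →
    ∣ C ∩ D ∣ ≤ ∣ A ∩ D ∣ + (d + 2 * i)
  meet-after-two-steps A B C D ∣A∣ ∣B∣ ∣D∣ A~B B~C =
    two-step-arith {k} {i} {∣ A ∩ D ∣} {∣ B ∩ D ∣} {∣ C ∩ D ∣} {d} three-sets two-sets
    where
    open ≤-Reasoning
    three-sets : k + k + k ≤ i + (∣ A ∩ D ∣ + ∣ B ∩ D ∣ + (2 * k + d))
    three-sets = begin
      k + k + k                                    ≡⟨ cong₂ _+_ (cong₂ _+_ ∣A∣ ∣B∣) ∣D∣ ⟨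
      ∣ A ∣ + ∣ B ∣ + ∣ D ∣                        ≤⟨ ∣p∣+∣q∣+∣r∣≤∣p∩q∣+∣p∩r∣+∣q∩r∣+n A B D ⟩
      ∣ A ∩ B ∣ + (∣ A ∩ D ∣ + ∣ B ∩ D ∣ + v)      ≡⟨ cong₂ (λ x y → x + (∣ A ∩ D ∣ + ∣ B ∩ D ∣ + y)) A~B (sym 2k+d≡v) ⟩
      i + (∣ A ∩ D ∣ + ∣ B ∩ D ∣ + (2 * k + d))    ∎
    two-sets : ∣ B ∩ D ∣ + ∣ C ∩ D ∣ ≤ i + k
    two-sets = subst₂ (λ x y → ∣ B ∩ D ∣ + ∣ C ∩ D ∣ ≤ x + y) B~C ∣D∣ (∣p∩r∣+∣q∩r∣≤∣p∩q∣+∣r∣ B C D)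

  module _ {U : ℕ → Subset v} (vertex : ∀ j → IsVertex v k (U j))
           (step : ∀ j → Adj v i (U j) (U (suc j))) where

    meet-after-odd-walk : ∀ p r → ∣ U (p + suc (2 * r)) ∩ U p ∣ ≤ i + r * (d + 2 * i)
    meet-after-odd-walk p zero = ≤-reflexive (begin
      ∣ U (p + 1) ∩ U p ∣    ≡⟨ cong (λ j → ∣ U j ∩ U p ∣) (+-comm p 1) ⟩
      ∣ U (suc p) ∩ U p ∣    ≡⟨ cong ∣_∣ (∩-comm (U (suc p)) (U p)) ⟩
      ∣ U p ∩ U (suc p) ∣    ≡⟨ step p ⟩
      i                      ≡⟨ +-identityʳ i ⟨
      i + 0                  ∎)
      where open ≡-Reasoning
    meet-after-odd-walk p (suc r) = begin
      ∣ U (p + suc (2 * suc r)) ∩ U p ∣          ≡⟨ cong (λ j → ∣ U j ∩ U p ∣) (two-more p r) ⟩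
      ∣ U (suc (suc j)) ∩ U p ∣                  ≤⟨ meet-after-two-steps (U j) (U (suc j)) (U (suc (suc j))) (U p)
                                                      (vertex j) (vertex (suc j)) (vertex p) (step j) (step (suc j)) ⟩
      ∣ U j ∩ U p ∣ + Δ                          ≤⟨ +-monoˡ-≤ Δ (meet-after-odd-walk p r) ⟩
      i + r * Δ + Δ                              ≡⟨ +-assoc i (r * Δ) Δ ⟩
      i + (r * Δ + Δ)                            ≡⟨ cong (i +_) (+-comm (r * Δ) Δ) ⟩
      i + suc r * Δ                              ∎
      where
      open ≤-Reasoning
      Δ = d + 2 * i
      j = p + suc (2 * r)
      two-more : ∀ p r → p + suc (2 * suc r) ≡ suc (suc (p + suc (2 * r)))
      two-more = solve-∀

    odd-return-bound : ∀ p s → U (p + suc (2 * s)) ≡ U p → k ≤ i + s * (d + 2 * i)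
    odd-return-bound p s back = begin
      k                                ≡⟨ vertex p ⟨
      ∣ U p ∣                          ≡⟨ cong ∣_∣ (∩-idem (U p)) ⟨
      ∣ U p ∩ U p ∣                    ≡⟨ cong (λ X → ∣ X ∩ U p ∣) back ⟨
      ∣ U (p + suc (2 * s)) ∩ U p ∣    ≤⟨ meet-after-odd-walk p s ⟩
      i + s * (d + 2 * i)              ∎
      where open ≤-Reasoning

odd-2+ : ∀ {n} → Odd n → Odd (2 + n)
odd-2+ (t , n≡) = suc t , trans (cong (2 +_) n≡) (cong suc (sym (*-suc 2 t)))

odd-2+⁻¹ : ∀ {n} → Odd (2 + n) → Odd n
odd-2+⁻¹ (suc t , 2+n≡) = t , suc-injective (suc-injective (trans 2+n≡ (cong suc (*-suc 2 t))))

odd-+ : ∀ a b → Odd (a + b) → Odd a ⊎ Odd b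
odd-+ zero          b odd = inj₂ odd
odd-+ (suc zero)    b odd = inj₁ (0 , refl)
odd-+ (suc (suc a)) b odd = Sum.map₁ odd-2+ (odd-+ a b (odd-2+⁻¹ odd))

[1+m]%n≡[1+m%n]%n : ∀ m n .{{_ : NonZero n}} → suc m % n ≡ suc (m % n) % n
[1+m]%n≡[1+m%n]%n m n =
  trans (cong (λ x → suc x % n) (m≡m%n+[m/n]*n m n)) ([m+kn]%n≡m%n (suc (m % n)) (m / n) n)

%-suc : ∀ m j → (j % suc m < m × suc j % suc m ≡ suc (j % suc m))
              ⊎ (j % suc m ≡ m × suc j % suc m ≡ 0)
%-suc m j with m≤n⇒m<n∨m≡n (s≤s⁻¹ (m%n<n j (suc m)))
... | inj₁ r<m = inj₁ (r<m , trans ([1+m]%n≡[1+m%n]%n j (suc m)) (m<n⇒m%n≡m (s≤s r<m)))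
... | inj₂ r≡m = inj₂ (r≡m , trans ([1+m]%n≡[1+m%n]%n j (suc m))
                                    (trans (cong (λ x → suc x % suc m) r≡m) (n%n≡0 (suc m))))

module Unroll {a ℓ} {V : Set a} (_~_ : V → V → Set ℓ) {m : ℕ} (g : Fin (suc m) → V)
              (step : ∀ (j : Fin m) → g (inject₁ j) ~ g (suc j)) (close : g (fromℕ m) ~ g zero) where

  unroll : ℕ → V
  unroll j = g (j mod suc m)

  private
    g≡unroll : ∀ {ι} j → toℕ ι ≡ j % suc m → g ι ≡ unroll j
    g≡unroll j ι≡ = cong g (toℕ-injective (trans ι≡ (sym (toℕ-fromℕ< _))))

  unroll-toℕ : ∀ ι → unroll (toℕ ι) ≡ g ι
  unroll-toℕ ι = sym (g≡unroll (toℕ ι) (sym (m<n⇒m%n≡m (toℕ<n ι))))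

  unroll-periodic : ∀ j → unroll (suc m + j) ≡ unroll j
  unroll-periodic j = sym (g≡unroll (suc m + j) (trans (toℕ-fromℕ< _)
    (sym (trans (cong (_% suc m) (+-comm (suc m) j)) ([m+n]%n≡m%n j (suc m))))))

  unroll-step : ∀ j → unroll j ~ unroll (suc j)
  unroll-step j with %-suc m j
  ... | inj₁ (r<m , e) = subst₂ _~_ (g≡unroll j (trans (toℕ-inject₁ _) (toℕ-fromℕ< r<m)))
                                    (g≡unroll (suc j) (trans (cong suc (toℕ-fromℕ< r<m)) (sym e)))
                                    (step (fromℕ< r<m))
  ... | inj₂ (r≡m , e) = subst₂ _~_ (g≡unroll j (trans (toℕ-fromℕ m) (sym r≡m)))
                                    (g≡unroll (suc j) (sym e))
                                    close

module _ {a} {V : Set a} (W : ℕ → V) {n : ℕ} (periodic : ∀ j → W (n + j) ≡ W j) (n-odd : Odd n)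
         (odd-return-long : ∀ p ℓ → Odd ℓ → W (p + ℓ) ≡ W p → n ≤ ℓ) where

  -- The returns at p and q split the closed walk of length n into closed walks of lengths
  -- ℓ₁ = q − p and ℓ₂ = n − ℓ₁, both shorter than n; since n is odd, one of them is odd.
  no-early-return : ∀ {p q} → p < q → q < n → W p ≢ W q
  no-early-return {p} {q} p<q q<n = gaps (m≤n⇒∃[o]m+o≡n p<q) (m≤n⇒∃[o]m+o≡n q<n)
    where
    gaps : (Σ ℕ λ δ → suc p + δ ≡ q) → (Σ ℕ λ ε → suc q + ε ≡ n) → W p ≢ W q
    gaps (δ , q≡) (ε , n≡) Wp≡Wq =
      [ (λ odd → <⇒≱ ℓ₁<n (odd-return-long p ℓ₁ odd (trans (cong W p+ℓ₁≡q) (sym Wp≡Wq))))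
      , (λ odd → <⇒≱ ℓ₂<n (odd-return-long q ℓ₂ odd (trans (cong W q+ℓ₂≡n+p) (trans (periodic p) Wp≡Wq))))
      ]′ (odd-+ ℓ₁ ℓ₂ (subst Odd (sym ℓ₁+ℓ₂≡n) n-odd))
      where
      ℓ₁ ℓ₂ : ℕ
      ℓ₁ = suc δ
      ℓ₂ = suc ε + p
      split : ∀ p δ ε → suc δ + (suc ε + p) ≡ suc (suc p + δ) + ε
      split = solve-∀
      ℓ₁+ℓ₂≡n : ℓ₁ + ℓ₂ ≡ n
      ℓ₁+ℓ₂≡n = trans (split p δ ε) (trans (cong (λ x → suc x + ε) q≡) n≡)
      p+ℓ₁≡q : p + ℓ₁ ≡ q
      p+ℓ₁≡q = trans (+-suc p δ) q≡
      q+ℓ₂≡n+p : q + ℓ₂ ≡ n + p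
      q+ℓ₂≡n+p = trans (sym (+-assoc q (suc ε) p)) (cong (_+ p) (trans (+-suc q ε) n≡))
      ℓ₁<n : ℓ₁ < n
      ℓ₁<n = subst (ℓ₁ <_) ℓ₁+ℓ₂≡n (m<m+n ℓ₁ z<s)
      ℓ₂<n : ℓ₂ < n
      ℓ₂<n = subst (ℓ₂ <_) ℓ₁+ℓ₂≡n (m<n+m ℓ₂ z<s)

  injective-below : ∀ {p q} → p < n → q < n → W p ≡ W q → p ≡ q
  injective-below {p} {q} p<n q<n Wp≡Wq with <-cmp p q
  ... | tri< p<q _ _ = contradiction Wp≡Wq (no-early-return p<q q<n)
  ... | tri≈ _ p≡q _ = p≡q
  ... | tri> _ _ q<p = contradiction (sym Wp≡Wq) (no-early-return q<p p<n)

odd-cycle-bound : ∀ {v k i d m s} → 2 * k + d ≡ v → Cycle v k i m → suc m ≡ suc (2 * s) →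
                  k ≤ i + s * (d + 2 * i)
odd-cycle-bound {v} {k} {i} {d} {m} {s} 2k+d≡v C m≡ =
  odd-return-bound 2k+d≡v {U = unroll} (λ j → isVert (j mod suc m)) unroll-step 0 s closed
  where
  open Cycle C
  open Unroll (Adj v i) vert step close
  closed : unroll (suc (2 * s)) ≡ unroll 0
  closed = trans (cong unroll (trans (sym m≡) (sym (+-identityʳ (suc m))))) (unroll-periodic 0)

ceilDiv-least : ∀ {a b s} → a ≤ s * b → ceilDiv a b ≤ s
ceilDiv-least {b = zero} _ = z≤n
ceilDiv-least {a} {suc b} {s} a≤sb = s≤s⁻¹ (m<n*o⇒m/o<n (begin-strict
  a + b               ≤⟨ +-monoˡ-≤ b a≤sb ⟩
  s * suc b + b       <⟨ +-monoʳ-< (s * suc b) (n<1+n b) ⟩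
  s * suc b + suc b   ≡⟨ +-comm (s * suc b) (suc b) ⟩
  suc s * suc b       ∎))
  where open ≤-Reasoning

ceilDiv-decompose : ∀ {a b} → 1 ≤ a → 1 ≤ b →
  Σ ℕ λ t → Σ ℕ λ x → ceilDiv a b ≡ suc t × x + t * b ≡ a × 1 ≤ x × x ≤ b
ceilDiv-decompose {a} {suc b} 1≤a _ with (a + b) / suc b | m≡m%n+[m/n]*n (a + b) (suc b)
... | zero  | a+b≡r = contradiction (≤-trans 1≤a (+-cancelʳ-≤ b a 0 a+b≤b)) λ ()
  where
  a+b≤b : a + b ≤ b
  a+b≤b = s≤s⁻¹ (subst (_< suc b) (trans (sym (+-identityʳ _)) (sym a+b≡r)) (m%n<n (a + b) (suc b)))
... | suc t | a+b≡r = t , suc r , refl , +-cancelʳ-≡ b _ _ (trans (shift r t b) (sym a+b≡r)) ,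
                      s≤s z≤n , m%n<n (a + b) (suc b)
  where
  r = (a + b) % suc b
  shift : ∀ r t b → suc r + t * suc b + b ≡ r + suc t * suc b
  shift = solve-∀

odd-cycle-long : ∀ {v k i m} → 2 * k ≤ v → Odd (suc m) → Cycle v k i m →
                 2 * ceilDiv (k ∸ i) ((v ∸ 2 * k) + 2 * i) + 1 ≤ suc m
odd-cycle-long {v} {k} {i} {m} 2k≤v (s , m≡) C = begin
  2 * ceilDiv (k ∸ i) Δ + 1   ≡⟨ +-comm _ 1 ⟩
  suc (2 * ceilDiv (k ∸ i) Δ) ≤⟨ s≤s (*-monoʳ-≤ 2 (ceilDiv-least {s = s} (m≤n+o⇒m∸n≤o k i k≤))) ⟩
  suc (2 * s)                 ≡⟨ m≡ ⟨
  suc m                       ∎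
  where
  open ≤-Reasoning
  Δ = (v ∸ 2 * k) + 2 * i
  k≤ : k ≤ i + s * Δ
  k≤ = odd-cycle-bound {d = v ∸ 2 * k} {s = s} (m+[n∸m]≡n 2k≤v) C m≡

-- Rotations and run-length encodings of bit lists

rotate : ∀ {a} {A : Set a} → ℕ → List A → List A
rotate zero    xs       = xs
rotate (suc n) []       = []
rotate (suc n) (x ∷ xs) = rotate n (xs ∷ʳ x)

module _ {a} {A : Set a} where

  replicate-+ : ∀ m n (x : A) → replicate (m + n) x ≡ replicate m x ++ replicate n x
  replicate-+ zero    n x = refl
  replicate-+ (suc m) n x = cong (x ∷_) (replicate-+ m n x)

  length-∷ʳ : ∀ (xs : List A) x → length (xs ∷ʳ x) ≡ suc (length xs)
  length-∷ʳ xs x = trans (length-++ xs) (+-comm (length xs) 1)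

  length-rotate : ∀ n (xs : List A) → length (rotate n xs) ≡ length xs
  length-rotate zero    xs       = refl
  length-rotate (suc n) []       = refl
  length-rotate (suc n) (x ∷ xs) = trans (length-rotate n (xs ∷ʳ x)) (length-∷ʳ xs x)

  rotate-[] : ∀ n → rotate n [] ≡ ([] {A = A})
  rotate-[] zero    = refl
  rotate-[] (suc n) = refl

  rotate-+ : ∀ m n (xs : List A) → rotate (m + n) xs ≡ rotate n (rotate m xs)
  rotate-+ zero    n xs       = refl
  rotate-+ (suc m) n []       = sym (rotate-[] n)
  rotate-+ (suc m) n (x ∷ xs) = rotate-+ m n (xs ∷ʳ x)

  rotate-++ : ∀ (xs ys : List A) → rotate (length xs) (xs ++ ys) ≡ ys ++ xs
  rotate-++ []       ys = sym (++-identityʳ ys)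
  rotate-++ (x ∷ xs) ys = begin
    rotate (length xs) ((xs ++ ys) ∷ʳ x)   ≡⟨ cong (rotate (length xs)) (++-assoc xs ys [ x ]) ⟩
    rotate (length xs) (xs ++ ys ∷ʳ x)     ≡⟨ rotate-++ xs (ys ∷ʳ x) ⟩
    (ys ∷ʳ x) ++ xs                        ≡⟨ ++-assoc ys [ x ] xs ⟩
    ys ++ x ∷ xs                           ∎
    where open ≡-Reasoning

  rotate-length : ∀ (xs : List A) → rotate (length xs) xs ≡ xs
  rotate-length xs = trans (cong (rotate (length xs)) (sym (++-identityʳ xs))) (rotate-++ xs [])

  rotate-*-length : ∀ t (xs : List A) → rotate (t * length xs) xs ≡ xs
  rotate-*-length zero    xs = refl
  rotate-*-length (suc t) xs = begin
    rotate (length xs + t * length xs) xs          ≡⟨ rotate-+ (length xs) (t * length xs) xs ⟩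
    rotate (t * length xs) (rotate (length xs) xs) ≡⟨ cong (rotate (t * length xs)) (rotate-length xs) ⟩
    rotate (t * length xs) xs                      ≡⟨ rotate-*-length t xs ⟩
    xs                                             ∎
    where open ≡-Reasoning

module _ {a b c} {A : Set a} {B : Set b} {C : Set c} (f : A → B → C) where

  zipWith-++ : ∀ xs ys {xs′ ys′} → length xs ≡ length ys →
               zipWith f (xs ++ xs′) (ys ++ ys′) ≡ zipWith f xs ys ++ zipWith f xs′ ys′
  zipWith-++ []       []       _   = refl
  zipWith-++ (x ∷ xs) (y ∷ ys) len = cong (f x y ∷_) (zipWith-++ xs ys (suc-injective len))

  zipWith-rotate : ∀ n {xs ys} → length xs ≡ length ys →
                   zipWith f (rotate n xs) (rotate n ys) ≡ rotate n (zipWith f xs ys)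
  zipWith-rotate zero    {xs}     {ys}     _   = refl
  zipWith-rotate (suc n) {[]}     {[]}     _   = refl
  zipWith-rotate (suc n) {x ∷ xs} {y ∷ ys} len = begin
    zipWith f (rotate n (xs ∷ʳ x)) (rotate n (ys ∷ʳ y))  ≡⟨ zipWith-rotate n len′ ⟩
    rotate n (zipWith f (xs ∷ʳ x) (ys ∷ʳ y))             ≡⟨ cong (rotate n) (zipWith-++ xs ys (suc-injective len)) ⟩
    rotate n (zipWith f xs ys ∷ʳ f x y)                  ∎
    where
    open ≡-Reasoning
    len′ : length (xs ∷ʳ x) ≡ length (ys ∷ʳ y)
    len′ = trans (length-∷ʳ xs x) (trans len (sym (length-∷ʳ ys y)))

trues : List Bool → ℕ
trues []           = 0
trues (true  ∷ xs) = suc (trues xs)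
trues (false ∷ xs) = trues xs

trues-++ : ∀ xs ys → trues (xs ++ ys) ≡ trues xs + trues ys
trues-++ []           ys = refl
trues-++ (true  ∷ xs) ys = cong suc (trues-++ xs ys)
trues-++ (false ∷ xs) ys = trues-++ xs ys

trues-replicate : ∀ n β → trues (replicate n β) ≡ (if β then n else 0)
trues-replicate zero    true  = refl
trues-replicate zero    false = refl
trues-replicate (suc n) true  = cong suc (trues-replicate n true)
trues-replicate (suc n) false = trues-replicate n false

trues-rotate : ∀ n xs → trues (rotate n xs) ≡ trues xs
trues-rotate zero    xs       = refl
trues-rotate (suc n) []       = refl
trues-rotate (suc n) (x ∷ xs) = begin
  trues (rotate n (xs ∷ʳ x))   ≡⟨ trues-rotate n (xs ∷ʳ x) ⟩
  trues (xs ++ [ x ])          ≡⟨ trues-++ xs [ x ] ⟩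
  trues xs + trues [ x ]       ≡⟨ +-comm (trues xs) (trues [ x ]) ⟩
  trues [ x ] + trues xs       ≡⟨ trues-++ [ x ] xs ⟨
  trues (x ∷ xs)               ∎
  where open ≡-Reasoning

infixr 7 _&_
_&_ : List Bool → List Bool → List Bool
_&_ = zipWith _∧_

-- Run-length encoded bit lists with the same run lengths intersect run by run (decode-&), so once
-- two sets are refined to a common profile their overlap is computed by normalisation.
Runs : Set
Runs = List (Bool × ℕ)

decode : Runs → List Bool
decode []            = []
decode ((β , n) ∷ r) = replicate n β ++ decode r

weight : Runs → ℕ
weight []            = 0
weight ((β , n) ∷ r) = (if β then n else 0) + weight r

infixr 7 _&ᴿ_
_&ᴿ_ : Runs → Runs → Runs
_&ᴿ_ = zipWith λ (β , n) (β′ , _) → β ∧ β′ , n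

refine : Runs → List (List ℕ) → Runs
refine ((β , _) ∷ r) (ns ∷ nss) = map (β ,_) ns ++ refine r nss
refine _             _          = []

decode-++ : ∀ r r′ → decode (r ++ r′) ≡ decode r ++ decode r′
decode-++ []            r′ = refl
decode-++ ((β , n) ∷ r) r′ = trans (cong (replicate n β ++_) (decode-++ r r′))
                                   (sym (++-assoc (replicate n β) (decode r) (decode r′)))

trues-decode : ∀ r → trues (decode r) ≡ weight r
trues-decode []            = refl
trues-decode ((β , n) ∷ r) = trans (trues-++ (replicate n β) (decode r))
                                   (cong₂ _+_ (trues-replicate n β) (trues-decode r))

length-decode : ∀ r → length (decode r) ≡ sum (map proj₂ r)
length-decode []            = refl
length-decode ((β , n) ∷ r) = trans (length-++ (replicate n β))
                                    (cong₂ _+_ (length-replicate n) (length-decode r))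

decode-& : ∀ r r′ → map proj₂ r ≡ map proj₂ r′ → decode r & decode r′ ≡ decode (r &ᴿ r′)
decode-& []            []              _    = refl
decode-& ((β , n) ∷ r) ((β′ , n′) ∷ r′) same with ∷-injective same
... | refl , same′ = begin
  (replicate n β ++ decode r) & (replicate n β′ ++ decode r′)
    ≡⟨ zipWith-++ _∧_ (replicate n β) (replicate n β′) (trans (length-replicate n) (sym (length-replicate n))) ⟩
  (replicate n β & replicate n β′) ++ (decode r & decode r′)
    ≡⟨ cong₂ _++_ (zipWith-replicate n _∧_ β β′) (decode-& r r′ same′) ⟩
  replicate n (β ∧ β′) ++ decode (r &ᴿ r′)
    ∎
  where open ≡-Reasoning

trues-&-decode : ∀ r r′ → map proj₂ r ≡ map proj₂ r′ → trues (decode r & decode r′) ≡ weight (r &ᴿ r′)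
trues-&-decode r r′ same = trans (cong trues (decode-& r r′ same)) (trues-decode (r &ᴿ r′))

rotate-decode : ∀ β n r → rotate n (decode ((β , n) ∷ r)) ≡ decode (r ∷ʳ (β , n))
rotate-decode β n r = begin
  rotate n (replicate n β ++ decode r)   ≡⟨ cong (λ m → rotate m (replicate n β ++ decode r)) (length-replicate n) ⟨
  rotate (length (replicate n β)) (replicate n β ++ decode r)
                                         ≡⟨ rotate-++ (replicate n β) (decode r) ⟩
  decode r ++ replicate n β              ≡⟨ cong (decode r ++_) (++-identityʳ (replicate n β)) ⟨
  decode r ++ decode [ β , n ]           ≡⟨ decode-++ r [ β , n ] ⟨
  decode (r ∷ʳ (β , n))                  ∎
  where open ≡-Reasoning

decode-pieces : ∀ β ns → decode (map (β ,_) ns) ≡ replicate (sum ns) β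
decode-pieces β []       = refl
decode-pieces β (n ∷ ns) =
  trans (cong (replicate n β ++_) (decode-pieces β ns)) (sym (replicate-+ n (sum ns) β))

decode-refine : ∀ {r} nss → Pointwise (λ run ns → proj₂ run ≡ sum ns) r nss →
                decode r ≡ decode (refine r nss)
decode-refine []         []             = refl
decode-refine {(β , n) ∷ r} (ns ∷ nss) (n≡ ∷ splits) = begin
  replicate n β ++ decode r                          ≡⟨ cong₂ (λ m s → replicate m β ++ s) n≡ (decode-refine nss splits) ⟩
  replicate (sum ns) β ++ decode (refine r nss)      ≡⟨ cong (_++ decode (refine r nss)) (decode-pieces β ns) ⟨
  decode (map (β ,_) ns) ++ decode (refine r nss)    ≡⟨ decode-++ (map (β ,_) ns) (refine r nss) ⟨
  decode (map (β ,_) ns ++ refine r nss)             ∎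
  where open ≡-Reasoning

toSubset : ∀ n → List Bool → Subset n
toSubset zero    _        = []
toSubset (suc n) []       = outside ∷ toSubset n []
toSubset (suc n) (x ∷ xs) = x ∷ toSubset n xs

∣toSubset∣ : ∀ {n} xs → length xs ≡ n → ∣ toSubset n xs ∣ ≡ trues xs
∣toSubset∣ []           refl = refl
∣toSubset∣ (true  ∷ xs) refl = cong suc (∣toSubset∣ xs refl)
∣toSubset∣ (false ∷ xs) refl = ∣toSubset∣ xs refl

toSubset-∩ : ∀ {n} xs ys → length xs ≡ n → length ys ≡ n →
             toSubset n xs ∩ toSubset n ys ≡ toSubset n (xs & ys)
toSubset-∩ []       []       refl refl = refl
toSubset-∩ (x ∷ xs) (y ∷ ys) refl len  = cong (x ∧ y ∷_) (toSubset-∩ xs ys refl (suc-injective len))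
toSubset-∩ []       (y ∷ ys) refl ()
toSubset-∩ (x ∷ xs) []       refl ()

IsVertexᴸ : ℕ → ℕ → List Bool → Set
IsVertexᴸ v k xs = length xs ≡ v × trues xs ≡ k

Adjᴸ : ℕ → List Bool → List Bool → Set
Adjᴸ i xs ys = trues (xs & ys) ≡ i

toSubset-vertex : ∀ {v k xs} → IsVertexᴸ v k xs → IsVertex v k (toSubset v xs)
toSubset-vertex {xs = xs} (len , ∣xs∣) = trans (∣toSubset∣ xs len) ∣xs∣

toSubset-adj : ∀ {v i xs ys} → length xs ≡ v → length ys ≡ v → Adjᴸ i xs ys →
               Adj v i (toSubset v xs) (toSubset v ys)
toSubset-adj {v} {i} {xs} {ys} lenx leny xs~ys = begin
  ∣ toSubset v xs ∩ toSubset v ys ∣   ≡⟨ cong ∣_∣ (toSubset-∩ xs ys lenx leny) ⟩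
  ∣ toSubset v (xs & ys) ∣            ≡⟨ ∣toSubset∣ (xs & ys) len& ⟩
  trues (xs & ys)                     ≡⟨ xs~ys ⟩
  i                                   ∎
  where
  open ≡-Reasoning
  len& : length (xs & ys) ≡ v
  len& = trans (length-zipWith _∧_ xs ys) (trans (cong₂ _⊓_ lenx leny) (⊓-idem v))

-- Arcs on a circle

arc : ℕ → ℕ → List Bool
arc k d = decode ((true , k) ∷ (false , k + d) ∷ [])

arc-vertex : ∀ k d → IsVertexᴸ (2 * k + d) k (arc k d)
arc-vertex k d = trans (length-decode runs) (lengths k d) , trans (trues-decode runs) (+-identityʳ k)
  where
  runs : Runs
  runs = (true , k) ∷ (false , k + d) ∷ []
  lengths : ∀ k d → k + (k + d + 0) ≡ 2 * k + d
  lengths = solve-∀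

rotate-arc : ∀ {k} x y d → k ≡ x + y →
             rotate x (arc k d) ≡ decode ((true , y) ∷ (false , k + d) ∷ (true , x) ∷ [])
rotate-arc {k} x y d k≡ = begin
  rotate x (arc k d)
    ≡⟨ cong (rotate x) (decode-refine ((x ∷ y ∷ []) ∷ (k + d ∷ []) ∷ [])
         (trans k≡ (cong (x +_) (sym (+-identityʳ y))) ∷ sym (+-identityʳ (k + d)) ∷ [])) ⟩
  rotate x (decode ((true , x) ∷ (true , y) ∷ (false , k + d) ∷ []))
    ≡⟨ rotate-decode true x ((true , y) ∷ (false , k + d) ∷ []) ⟩
  decode ((true , y) ∷ (false , k + d) ∷ (true , x) ∷ []) ∎
  where open ≡-Reasoning

arc-&-rotate : ∀ {k i} c d → k ≡ c + i → Adjᴸ i (arc k d) (rotate c (arc k d))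
arc-&-rotate {k} {i} c d k≡ = begin
  trues (arc k d & rotate c (arc k d))   ≡⟨ cong₂ (λ X Y → trues (X & Y)) arc≡ rotated≡ ⟩
  trues (decode R & decode R′)          ≡⟨ trues-&-decode R R′ refl ⟩
  i + 0                                 ≡⟨ +-identityʳ i ⟩
  i                                     ∎
  where
  open ≡-Reasoning
  R R′ : Runs
  R  = (true , i) ∷ (true  , c) ∷ (false , i + d) ∷ (false , c) ∷ []
  R′ = (true , i) ∷ (false , c) ∷ (false , i + d) ∷ (true  , c) ∷ []
  swap : ∀ c i → c + i ≡ i + (c + 0)
  swap = solve-∀
  swap₃ : ∀ c i d → c + i + d ≡ i + d + (c + 0)
  swap₃ = solve-∀
  pad₃ : ∀ c i d → c + i + d ≡ c + (i + d + 0)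
  pad₃ = solve-∀
  arc≡ : arc k d ≡ decode R
  arc≡ = decode-refine ((i ∷ c ∷ []) ∷ (i + d ∷ c ∷ []) ∷ [])
           (trans k≡ (swap c i) ∷ trans (cong (_+ d) k≡) (swap₃ c i d) ∷ [])
  rotated≡ : rotate c (arc k d) ≡ decode R′
  rotated≡ = trans (rotate-arc c i d k≡) (decode-refine ((i ∷ []) ∷ (c ∷ i + d ∷ []) ∷ (c ∷ []) ∷ [])
               (sym (+-identityʳ i) ∷ trans (cong (_+ d) k≡) (pad₃ c i d) ∷ sym (+-identityʳ c) ∷ []))

CommonNeighbour : ℕ → ℕ → ℕ → List Bool → List Bool → Set
CommonNeighbour v k i X Y = Σ (List Bool) λ B → IsVertexᴸ v k B × Adjᴸ i X B × Adjᴸ i B Y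

-- Cut the circle into the runs I ∩ J (a + a′), I ∖ J (b + b′), outside I ∪ J (e + e′) and J ∖ I
-- (b + b′), where J is I rotated by x; B takes the first a, b, e and b points of these runs.
module ArcNeighbour {k d x i : ℕ} (a a′ b b′ e e′ : ℕ)
  (k≡ : k ≡ x + (a + a′)) (x≡ : x ≡ b + b′) (k+d≡ : k + d ≡ x + (e + e′))
  (∣B∣≡ : a + (b + (e + b)) ≡ k) (a+b≡i : a + b ≡ i) where

  I J B : Runs
  I = (true , a) ∷ (true  , a′) ∷ (true  , b) ∷ (true  , b′) ∷ (false , e) ∷ (false , e′) ∷ (false , b) ∷ (false , b′) ∷ []
  J = (true , a) ∷ (true  , a′) ∷ (false , b) ∷ (false , b′) ∷ (false , e) ∷ (false , e′) ∷ (true  , b) ∷ (true  , b′) ∷ []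
  B = (true , a) ∷ (false , a′) ∷ (true  , b) ∷ (false , b′) ∷ (true  , e) ∷ (false , e′) ∷ (true  , b) ∷ (false , b′) ∷ []

  arc≡I : arc k d ≡ decode I
  arc≡I = decode-refine ((a ∷ a′ ∷ b ∷ b′ ∷ []) ∷ (e ∷ e′ ∷ b ∷ b′ ∷ []) ∷ [])
    ( trans k≡   (trans (cong (_+ (a + a′)) x≡) (swap b b′ a a′))
    ∷ trans k+d≡ (trans (cong (_+ (e + e′)) x≡) (swap b b′ e e′))
    ∷ [])
    where
    swap : ∀ b b′ a a′ → b + b′ + (a + a′) ≡ a + (a′ + (b + (b′ + 0)))
    swap = solve-∀

  rotated≡J : rotate x (arc k d) ≡ decode J
  rotated≡J = trans (rotate-arc x (a + a′) d k≡)
    (decode-refine ((a ∷ a′ ∷ []) ∷ (b ∷ b′ ∷ e ∷ e′ ∷ []) ∷ (b ∷ b′ ∷ []) ∷ [])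
      ( cong (a +_) (sym (+-identityʳ a′))
      ∷ trans k+d≡ (trans (cong (_+ (e + e′)) x≡) (pad b b′ e e′))
      ∷ trans x≡ (cong (b +_) (sym (+-identityʳ b′)))
      ∷ []))
    where
    pad : ∀ b b′ e e′ → b + b′ + (e + e′) ≡ b + (b′ + (e + (e′ + 0)))
    pad = solve-∀

  B-vertex : IsVertexᴸ (2 * k + d) k (decode B)
  B-vertex = length-B , trans (trues-decode B) (trans (tidy a b e) ∣B∣≡)
    where
    open ≡-Reasoning
    tidy : ∀ a b e → a + (b + (e + (b + 0))) ≡ a + (b + (e + b))
    tidy = solve-∀
    length-B : length (decode B) ≡ 2 * k + d
    length-B = begin
      length (decode B)   ≡⟨ length-decode B ⟩
      sum (map proj₂ I)   ≡⟨ length-decode I ⟨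
      length (decode I)   ≡⟨ cong length arc≡I ⟨
      length (arc k d)    ≡⟨ proj₁ (arc-vertex k d) ⟩
      2 * k + d           ∎

  rotated&B : Adjᴸ i (rotate x (arc k d)) (decode B)
  rotated&B = begin
    trues (rotate x (arc k d) & decode B)   ≡⟨ cong (λ X → trues (X & decode B)) rotated≡J ⟩
    trues (decode J & decode B)             ≡⟨ trues-&-decode J B refl ⟩
    a + (b + 0)                             ≡⟨ cong (a +_) (+-identityʳ b) ⟩
    a + b                                   ≡⟨ a+b≡i ⟩
    i                                       ∎
    where open ≡-Reasoning

  B&arc : Adjᴸ i (decode B) (arc k d)
  B&arc = begin
    trues (decode B & arc k d)    ≡⟨ cong (λ X → trues (decode B & X)) arc≡I ⟩
    trues (decode B & decode I)   ≡⟨ trues-&-decode B I refl ⟩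
    a + (b + 0)                   ≡⟨ cong (a +_) (+-identityʳ b) ⟩
    a + b                         ≡⟨ a+b≡i ⟩
    i                             ∎
    where open ≡-Reasoning

  neighbour : CommonNeighbour (2 * k + d) k i (rotate x (arc k d)) (arc k d)
  neighbour = decode B , B-vertex , rotated&B , B&arc

-- An odd cycle of length 2⌈(k − i)/Δ⌉ + 1

module OddCycle (d i x T : ℕ) (1≤x : 1 ≤ x) (x≤Δ : x ≤ d + 2 * i) where

  Δ c k v m : ℕ
  Δ = d + 2 * i
  c = x + T * Δ
  k = c + i
  v = 2 * k + d
  m = 2 * suc T

  base : List Bool
  base = arc k d

  base-vertex : IsVertexᴸ v k base
  base-vertex = arc-vertex k d

  private
    t = T * Δ

  -- In ArcNeighbour, b = x: B contains I ∖ J and J ∖ I, and i − x points of I ∩ J.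
  neighbour-when-x≤i : x ≤ i → CommonNeighbour v k i (rotate x base) base
  neighbour-when-x≤i x≤i with m≤n⇒∃[o]m+o≡n x≤i
  ... | u , x+u≡i = ArcNeighbour.neighbour u (t + x) x 0 t (i + d)
                      k≡ (sym (+-identityʳ x)) (rearrange-k+d x t i d) ∣B∣≡ (trans (+-comm u x) x+u≡i)
    where
    rearrange-k : ∀ x t u → x + t + (x + u) ≡ x + (u + (t + x))
    rearrange-k = solve-∀
    rearrange-k+d : ∀ x t i d → x + t + i + d ≡ x + (t + (i + d))
    rearrange-k+d = solve-∀
    rearrange-∣B∣ : ∀ u x t → u + (x + (t + x)) ≡ x + t + (x + u)
    rearrange-∣B∣ = solve-∀
    k≡ : k ≡ x + (u + (t + x))
    k≡ = trans (cong (x + t +_) (sym x+u≡i)) (rearrange-k x t u)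
    ∣B∣≡ : u + (x + (t + x)) ≡ k
    ∣B∣≡ = trans (rearrange-∣B∣ u x t) (cong (x + t +_) x+u≡i)

  -- In ArcNeighbour, b = i: B avoids I ∩ J and takes i points of each of I ∖ J and J ∖ I.
  neighbour-when-i≤x : i ≤ x → CommonNeighbour v k i (rotate x base) base
  neighbour-when-i≤x i≤x with m≤n⇒∃[o]m+o≡n i≤x | m≤n⇒∃[o]m+o≡n x≤Δ
  ... | w , i+w≡x | z , x+z≡Δ = ArcNeighbour.neighbour 0 (t + i) i w (t + w) z
                                  (+-assoc x t i) (sym i+w≡x) k+d≡ ∣B∣≡ refl
    where
    open ≡-Reasoning
    rearrange-Δ : ∀ d i → d + 2 * i ≡ i + (i + d)
    rearrange-Δ = solve-∀
    rearrange-k+d : ∀ x t i d → x + t + i + d ≡ x + (t + (i + d))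
    rearrange-k+d = solve-∀
    rearrange-∣B∣ : ∀ i t w → i + (t + w + i) ≡ i + w + t + i
    rearrange-∣B∣ = solve-∀
    w+z≡i+d : w + z ≡ i + d
    w+z≡i+d = +-cancelˡ-≡ i (w + z) (i + d) (begin
      i + (w + z)   ≡⟨ +-assoc i w z ⟨
      i + w + z     ≡⟨ cong (_+ z) i+w≡x ⟩
      x + z         ≡⟨ x+z≡Δ ⟩
      d + 2 * i     ≡⟨ rearrange-Δ d i ⟩
      i + (i + d)   ∎)
    k+d≡ : k + d ≡ x + (t + w + z)
    k+d≡ = begin
      x + t + i + d       ≡⟨ rearrange-k+d x t i d ⟩
      x + (t + (i + d))   ≡⟨ cong (λ s → x + (t + s)) w+z≡i+d ⟨
      x + (t + (w + z))   ≡⟨ cong (x +_) (+-assoc t w z) ⟨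
      x + (t + w + z)     ∎
    ∣B∣≡ : i + (t + w + i) ≡ k
    ∣B∣≡ = trans (rearrange-∣B∣ i t w) (cong (λ y → y + t + i) i+w≡x)

  closing-neighbour : CommonNeighbour v k i (rotate x base) base
  closing-neighbour = [ neighbour-when-x≤i , neighbour-when-i≤x ]′ (≤-total x i)

  rotation-step : ∀ r → Adjᴸ i (rotate (r * c) base) (rotate (suc r * c) base)
  rotation-step r = begin
    trues (rotate (r * c) base & rotate (c + r * c) base)
      ≡⟨ cong (λ X → trues (rotate (r * c) base & X)) (rotate-+ c (r * c) base) ⟩
    trues (rotate (r * c) base & rotate (r * c) (rotate c base))
      ≡⟨ cong trues (zipWith-rotate _∧_ (r * c) (sym (length-rotate c base))) ⟩
    trues (rotate (r * c) (base & rotate c base))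
      ≡⟨ trues-rotate (r * c) (base & rotate c base) ⟩
    trues (base & rotate c base)
      ≡⟨ arc-&-rotate c d refl ⟩
    i ∎
    where open ≡-Reasoning

  full-turns : rotate (suc (2 * T) * c) base ≡ rotate x base
  full-turns = begin
    rotate (suc (2 * T) * c) base                  ≡⟨ cong (λ n → rotate n base) turns ⟩
    rotate (T * length base + x) base              ≡⟨ rotate-+ (T * length base) x base ⟩
    rotate x (rotate (T * length base) base)       ≡⟨ cong (rotate x) (rotate-*-length T base) ⟩
    rotate x base                                  ∎
    where
    open ≡-Reasoning
    arith : ∀ x T d i → suc (2 * T) * (x + T * (d + 2 * i)) ≡ T * (2 * (x + T * (d + 2 * i) + i) + d) + x
    arith = solve-∀
    turns : suc (2 * T) * c ≡ T * length base + x
    turns = trans (arith x T d i) (cong (λ ℓ → T * ℓ + x) (sym (proj₁ base-vertex)))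

  walk : ℕ → List Bool
  walk zero    = proj₁ closing-neighbour
  walk (suc r) = rotate (r * c) base

  walk-vertex : ∀ r → IsVertexᴸ v k (walk r)
  walk-vertex zero    = proj₁ (proj₂ closing-neighbour)
  walk-vertex (suc r) = trans (length-rotate (r * c) base) (proj₁ base-vertex)
                      , trans (trues-rotate (r * c) base) (proj₂ base-vertex)

  walk-step : ∀ r → Adjᴸ i (walk r) (walk (suc r))
  walk-step zero    = proj₂ (proj₂ (proj₂ closing-neighbour))
  walk-step (suc r) = rotation-step r

  walk-close : Adjᴸ i (walk m) (walk 0)
  walk-close = subst (λ j → Adjᴸ i (walk j) (walk 0)) (sym (*-suc 2 T))
                     (subst (λ X → Adjᴸ i X (walk 0)) (sym full-turns) (proj₁ (proj₂ (proj₂ closing-neighbour))))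

  vertex : Fin (suc m) → Subset v
  vertex ι = toSubset v (walk (toℕ ι))

  vertex-isVertex : ∀ ι → IsVertex v k (vertex ι)
  vertex-isVertex ι = toSubset-vertex (walk-vertex (toℕ ι))

  lift-adj : ∀ r s → Adjᴸ i (walk r) (walk s) → Adj v i (toSubset v (walk r)) (toSubset v (walk s))
  lift-adj r s = toSubset-adj (proj₁ (walk-vertex r)) (proj₁ (walk-vertex s))

  vertex-step : ∀ (ι : Fin m) → Adj v i (vertex (inject₁ ι)) (vertex (suc ι))
  vertex-step ι = subst (λ j → Adj v i (toSubset v (walk j)) (vertex (suc ι))) (sym (toℕ-inject₁ ι))
                        (lift-adj (toℕ ι) (suc (toℕ ι)) (walk-step (toℕ ι)))

  vertex-close : Adj v i (vertex (fromℕ m)) (vertex zero)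
  vertex-close = subst (λ j → Adj v i (toSubset v (walk j)) (vertex zero)) (sym (toℕ-fromℕ m))
                       (lift-adj m 0 walk-close)

  open Unroll (Adj v i) vertex vertex-step vertex-close

  k≤i+sΔ⇒T<s : ∀ {s} → k ≤ i + s * Δ → suc T ≤ s
  k≤i+sΔ⇒T<s {s} k≤ = *-cancelʳ-< Δ T s (begin-strict
    T * Δ       <⟨ +-monoˡ-≤ (T * Δ) 1≤x ⟩
    x + T * Δ   ≤⟨ +-cancelʳ-≤ i c (s * Δ) (subst (c + i ≤_) (+-comm i (s * Δ)) k≤) ⟩
    s * Δ       ∎)
    where open ≤-Reasoning

  odd-return-long : ∀ p ℓ → Odd ℓ → unroll (p + ℓ) ≡ unroll p → suc m ≤ ℓ
  odd-return-long p ℓ (s , refl) back =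
    s≤s (*-monoʳ-≤ 2 (k≤i+sΔ⇒T<s {s}
      (odd-return-bound refl {U = unroll} (λ j → vertex-isVertex (j mod suc m)) unroll-step p s back)))

  cycle : Cycle v k i m
  cycle = record
    { length≥3 = s≤s (*-monoʳ-≤ 2 (s≤s z≤n))
    ; vert     = vertex
    ; isVert   = vertex-isVertex
    ; distinct = λ {ι} {ι′} same → toℕ-injective
        (injective-below unroll unroll-periodic (suc T , refl) odd-return-long (toℕ<n ι) (toℕ<n ι′)
          (trans (unroll-toℕ ι) (trans same (sym (unroll-toℕ ι′)))))
    ; step     = vertex-step
    ; close    = vertex-close
    }

excess-positive : ∀ {v k i} → 2 * k ≤ v → ¬ (v ≡ 2 * k × i ≡ 0) → 1 ≤ (v ∸ 2 * k) + 2 * i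
excess-positive {v} {k} {i} 2k≤v non-degenerate = n≢0⇒n>0 λ Δ≡0 →
  non-degenerate ( trans (sym (m+[n∸m]≡n 2k≤v)) (trans (cong (2 * k +_) (m+n≡0⇒m≡0 _ Δ≡0)) (+-identityʳ _))
                 , m+n≡0⇒m≡0 i (m+n≡0⇒n≡0 (v ∸ 2 * k) Δ≡0))

odd-cycle-exists : ∀ {v k i} → i < k → 2 * k ≤ v → 1 ≤ (v ∸ 2 * k) + 2 * i →
                   Cycle v k i (2 * ceilDiv (k ∸ i) ((v ∸ 2 * k) + 2 * i))
odd-cycle-exists {v} {k} {i} i<k 2k≤v 1≤Δ with ceilDiv-decompose (m<n⇒0<n∸m i<k) 1≤Δ
... | T , x , ceil≡ , x+TΔ≡ , 1≤x , x≤Δ =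
  subst (Cycle v k i) (cong (2 *_) (sym ceil≡))
    (subst (λ V → Cycle V k i _) (m+[n∸m]≡n 2k≤v)
      (subst (λ K → Cycle (2 * K + d) K i _) K≡k (OddCycle.cycle d i x T 1≤x x≤Δ)))
  where
  d = v ∸ 2 * k
  K≡k : x + T * (d + 2 * i) + i ≡ k
  K≡k = trans (cong (_+ i) x+TΔ≡) (m∸n+n≡m (<⇒≤ i<k))

theorem5p5 : (v k i : ℕ) → i < k → k < v → 2 * k ≤ v →
    ¬ (v ≡ 2 * k × i ≡ 0) →
    OddGirth v k i (2 * ceilDiv (k ∸ i) ((v ∸ 2 * k) + 2 * i) + 1)
theorem5p5 v k i i<k _ 2k≤v non-degenerate =
  ( 2 * g , +-comm 1 (2 * g) , (g , +-comm (2 * g) 1)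
  , odd-cycle-exists i<k 2k≤v (excess-positive {k = k} 2k≤v non-degenerate))
  , λ m odd C → odd-cycle-long 2k≤v odd C
  where
  g = ceilDiv (k ∸ i) ((v ∸ 2 * k) + 2 * i)
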